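{- Let $(M;\oplus,0,\le)$ be a naturally ordered commutative monoid with neutral element $0$ satisfying: (E1) for every idempotent $a\in M$ and every $x\in[0,a]=\{z\in M:0\le z\le a\}$ the element $\lambda_a(x)=\min\{z\in[0,a]:x\oplus z=a\}$ exists and $([0,a];\oplus,\lambda_a,0,a)$ is an MV-algebra; (E2) for each $x\in M$ there is an idempotent $a\in M$ with $x\le a$. Then $\le$ is a lattice order, $(M,\le)$ is a distributive lattice with least element $0$, and, with $\vee,\wedge$ the lattice operations, $(M;\vee,\wedge,\oplus,0)$ is an EMV-algebra.
   Context: All monoids are commutative. A monoid $(M;\oplus,0)$ with a partial order $\le$ is ordered if $x\le y$ implies $x\oplus z\le y\oplus z$ for all $z$; it is naturally ordered if moreover $x\le y$ iff $x\oplus z=y$ for some $z\in M$. An element $a$ is idempotent if $a\oplus a=a$. An EMV-algebra is an algebra $(M;\vee,\wedge,\oplus,0)$ of type $\langle 2,2,2,0\rangle$ such that: (i) $(M;\oplus,0)$ is a commutative monoid with neutral element $0$; (ii) $(M;\vee,\wedge,0)$ is a distributive lattice with bottom element $0$; (iii) for each idempotent $a$, $([0,a];\oplus,\lambda_a,0,a)$ is an MV-algebra, where $[0,a]$ is taken in the lattice order and $\lambda_a(x)=\min\{z\in[0,a]:z\oplus x=a\}$; (iv) each element lies below some idempotent. -}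

module Defs where

open import Data.Product using (Σ; ∃; _×_; proj₁)
open import Relation.Binary.PropositionalEquality using (_≡_)
open import Relation.Binary.Structures using (IsPartialOrder)
open import Algebra.Structures using (IsCommutativeMonoid)
import Algebra.Lattice.Structures as AL

module _ {M : Set} where

  Idempotent : (M → M → M) → M → Set
  Idempotent _⊕_ a = a ⊕ a ≡ a

  Interval : (M → M → Set) → M → M → M → Set
  Interval _≤_ o a z = (o ≤ z) × (z ≤ a)

  IsLeast : (M → M → Set) → (M → Set) → M → Set
  IsLeast _≤_ P z = P z × (∀ w → P w → z ≤ w)

  record IsNaturallyOrderedCommMonoid (_⊕_ : M → M → M) (o : M)
                                      (_≤_ : M → M → Set) : Set where
    field
      isCommutativeMonoid : IsCommutativeMonoid _≡_ _⊕_ o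
      isPartialOrder      : IsPartialOrder _≡_ _≤_
      ordered             : ∀ {x y} z → x ≤ y → (x ⊕ z) ≤ (y ⊕ z)
      natural⇒            : ∀ {x y} → x ≤ y → ∃ λ z → x ⊕ z ≡ y
      natural⇐            : ∀ {x y} → (∃ λ z → x ⊕ z ≡ y) → x ≤ y

  -- (P ; ⊕ , neg , o , u) is an MV-algebra, where the carrier is the
  -- subset P of M, ⊕ and o are inherited from M, and neg is a function
  -- on P (given as a function of an element together with a proof of
  -- membership; neg-irrelevant says it depends only on the element).
  record IsMVAlgebraOn (P : M → Set) (_⊕_ : M → M → M)
                       (neg : (x : M) → P x → M) (o u : M) : Set where
    field
      o-closed       : P o
      ⊕-closed       : ∀ {x y} → P x → P y → P (x ⊕ y)
      neg-closed     : ∀ {x} (p : P x) → P (neg x p)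
      neg-irrelevant : ∀ {x} (p q : P x) → neg x p ≡ neg x q
      ⊕-assoc        : ∀ {x y z} → P x → P y → P z → (x ⊕ y) ⊕ z ≡ x ⊕ (y ⊕ z)
      ⊕-comm         : ∀ {x y} → P x → P y → x ⊕ y ≡ y ⊕ x
      ⊕-identityʳ    : ∀ {x} → P x → x ⊕ o ≡ x
      neg-involutive : ∀ {x} (p : P x) → neg (neg x p) (neg-closed p) ≡ x
      neg-o          : neg o o-closed ≡ u
      ⊕-top          : ∀ {x} → P x → x ⊕ neg o o-closed ≡ neg o o-closed
      łukasiewicz    : ∀ {x y} (p : P x) (q : P y) →
                       neg (neg x p ⊕ y) (⊕-closed (neg-closed p) q) ⊕ y
                         ≡ neg (neg y q ⊕ x) (⊕-closed (neg-closed q) p) ⊕ x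

  IntervalMV : (M → M → M) → M → (M → M → Set) → M → Set
  IntervalMV _⊕_ o _≤_ a =
    Σ ((x : M) → Interval _≤_ o a x →
         Σ M (IsLeast _≤_ (λ z → Interval _≤_ o a z × (x ⊕ z ≡ a))))
      λ lam → IsMVAlgebraOn (Interval _≤_ o a) _⊕_ (λ x p → proj₁ (lam x p)) o a

  LatticeOrder : (M → M → M) → M → M → Set
  LatticeOrder _∧_ x y = x ∧ y ≡ x

  record IsEMVAlgebra (_∨_ _∧_ _⊕_ : M → M → M) (o : M) : Set where
    field
      isCommutativeMonoid   : IsCommutativeMonoid _≡_ _⊕_ o
      isDistributiveLattice : AL.IsDistributiveLattice _≡_ _∨_ _∧_
      o-bottom              : ∀ x → o ∧ x ≡ o
      intervals             : ∀ a → Idempotent _⊕_ a →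
                              IntervalMV _⊕_ o (LatticeOrder _∧_) a
      bounded               : ∀ x → ∃ λ a → Idempotent _⊕_ a × LatticeOrder _∧_ x a

module Submission where

-- In each MV-algebra [o , a] the order of M is the MV-order: x ≤ y iff
-- ¬x ⊕ y = a.  So the MV-join ¬(¬x ⊕ y) ⊕ y and the MV-meet x ⊙ (¬x ⊕ y),
-- computed in any such interval containing x and y, are the join and meet of
-- x and y in M; the idempotents are directed (a ⊕ b is idempotent), so such an
-- interval always exists and the result does not depend on it.
-- Distributivity comes from residuation: x ⊙ y ≤ z iff x ≤ ¬y ⊕ z, so ⊙ y
-- preserves joins.

open import Defs
open import Data.Product using (Σ; ∃; _×_; _,_; proj₁; proj₂)
open import Relation.Binary.PropositionalEquality
  using (_≡_; refl; sym; trans; cong; cong₂; subst; subst₂; module ≡-Reasoning)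
open import Relation.Binary.Definitions using (Minimum)
open import Relation.Binary.Structures using (IsPartialOrder)
open import Relation.Binary.Lattice.Bundles using (DistributiveLattice)
open import Relation.Binary.Lattice.Definitions using (Supremum; Infimum)
import Relation.Binary.Lattice.Structures as OL
import Relation.Binary.Lattice.Properties.Lattice as LatticeProperties
import Relation.Binary.Lattice.Properties.DistributiveLattice as DistributiveLatticeProperties
open import Algebra.Bundles using (CommutativeSemigroup)
open import Algebra.Structures using (IsCommutativeMonoid)
import Algebra.Properties.CommutativeSemigroup as CommutativeSemigroupProperties

module _ {M : Set} {P Q : M → Set} {_⊕_ : M → M → M} {neg : (x : M) → Q x → M} {o u : M}
         (P⊆Q : ∀ {x} → P x → Q x) (Q⊆P : ∀ {x} → Q x → P x) where

  isMVAlgebraOn-resp : IsMVAlgebraOn Q _⊕_ neg o u →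
                       IsMVAlgebraOn P _⊕_ (λ x p → neg x (P⊆Q p)) o u
  isMVAlgebraOn-resp mv = record
    { o-closed       = Q⊆P o-closed
    ; ⊕-closed       = λ p q → Q⊆P (⊕-closed (P⊆Q p) (P⊆Q q))
    ; neg-closed     = λ p → Q⊆P (neg-closed (P⊆Q p))
    ; neg-irrelevant = λ p q → neg-irrelevant (P⊆Q p) (P⊆Q q)
    ; ⊕-assoc        = λ p q r → ⊕-assoc (P⊆Q p) (P⊆Q q) (P⊆Q r)
    ; ⊕-comm         = λ p q → ⊕-comm (P⊆Q p) (P⊆Q q)
    ; ⊕-identityʳ    = λ p → ⊕-identityʳ (P⊆Q p)
    ; neg-involutive = λ p → trans (neg-irrelevant _ _) (neg-involutive (P⊆Q p))
    ; neg-o          = trans (neg-irrelevant _ _) neg-o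
    ; ⊕-top          = λ {x} p →
        let ¬o≡¬o = neg-irrelevant (P⊆Q (Q⊆P o-closed)) o-closed in
        trans (cong (x ⊕_) ¬o≡¬o) (trans (⊕-top (P⊆Q p)) (sym ¬o≡¬o))
    ; łukasiewicz    = λ {x} {y} p q →
        trans (cong (_⊕ y) (neg-irrelevant _ _))
          (trans (łukasiewicz (P⊆Q p) (P⊆Q q)) (cong (_⊕ x) (neg-irrelevant _ _)))
    }
    where open IsMVAlgebraOn mv

module _ {M : Set} {_⊕_ : M → M → M} {o : M} {_≤₁_ _≤₂_ : M → M → Set}
         (≤₁⇒≤₂ : ∀ {x y} → x ≤₁ y → x ≤₂ y) (≤₂⇒≤₁ : ∀ {x y} → x ≤₂ y → x ≤₁ y) where

  intervalMV-resp : ∀ {a} → IntervalMV _⊕_ o _≤₁_ a → IntervalMV _⊕_ o _≤₂_ a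
  intervalMV-resp {a} (λₐ , mv) = λₐ′ , isMVAlgebraOn-resp to₁ to₂ mv
    where
    to₁ : ∀ {z} → Interval _≤₂_ o a z → Interval _≤₁_ o a z
    to₁ (o≤z , z≤a) = ≤₂⇒≤₁ o≤z , ≤₂⇒≤₁ z≤a
    to₂ : ∀ {z} → Interval _≤₁_ o a z → Interval _≤₂_ o a z
    to₂ (o≤z , z≤a) = ≤₁⇒≤₂ o≤z , ≤₁⇒≤₂ z≤a
    λₐ′ : (x : M) → Interval _≤₂_ o a x →
          Σ M (IsLeast _≤₂_ (λ z → Interval _≤₂_ o a z × (x ⊕ z ≡ a)))
    λₐ′ x x∈ with λₐ x (to₁ x∈)
    ... | z , (z∈ , x⊕z≡a) , least =
      z , (to₂ z∈ , x⊕z≡a) , λ w (w∈ , x⊕w≡a) → ≤₁⇒≤₂ (least w (to₁ w∈ , x⊕w≡a))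

module NaturallyOrdered {M : Set} {_⊕_ : M → M → M} {o : M} {_≤_ : M → M → Set}
                        (isNOCM : IsNaturallyOrderedCommMonoid _⊕_ o _≤_) where

  open IsNaturallyOrderedCommMonoid isNOCM public
  open IsCommutativeMonoid isCommutativeMonoid using (assoc; comm; identityˡ; identityʳ)
  open IsPartialOrder isPartialOrder public using (antisym)
    renaming (refl to ≤-refl; trans to ≤-trans; reflexive to ≤-reflexive)

  o-minimum : Minimum _≤_ o
  o-minimum x = natural⇐ (x , identityˡ x)

  x≤x⊕y : ∀ x y → x ≤ (x ⊕ y)
  x≤x⊕y x y = natural⇐ (y , refl)

  y≤x⊕y : ∀ x y → y ≤ (x ⊕ y)
  y≤x⊕y x y = natural⇐ (x , comm y x)

  ⊕-mono-≤ : ∀ {x y z w} → x ≤ y → z ≤ w → (x ⊕ z) ≤ (y ⊕ w)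
  ⊕-mono-≤ {x} {y} {z} {w} x≤y z≤w = ≤-trans (ordered z x≤y)
    (subst₂ _≤_ (comm z y) (comm w y) (ordered y z≤w))

  idempotent-⊕ : ∀ {a b} → Idempotent _⊕_ a → Idempotent _⊕_ b → Idempotent _⊕_ (a ⊕ b)
  idempotent-⊕ {a} {b} a⊕a≡a b⊕b≡b = trans (interchange a b a b) (cong₂ _⊕_ a⊕a≡a b⊕b≡b)
    where
    ⊕-commutativeSemigroup : CommutativeSemigroup _ _
    ⊕-commutativeSemigroup = record
      { isCommutativeSemigroup = IsCommutativeMonoid.isCommutativeSemigroup isCommutativeMonoid }
    open CommutativeSemigroupProperties ⊕-commutativeSemigroup using (interchange)

  module Interval (e : M) (mvₑ : IntervalMV _⊕_ o _≤_ e) where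

    open IsMVAlgebraOn (proj₂ mvₑ) using (neg-irrelevant; łukasiewicz)
      renaming (⊕-closed to ⊕-closed′; neg-involutive to neg-involutive′)

    below : ∀ {x} → x ≤ e → Interval _≤_ o e x
    below {x} x≤e = o-minimum x , x≤e

    ⊕-closed : ∀ {x y} → x ≤ e → y ≤ e → (x ⊕ y) ≤ e
    ⊕-closed x≤e y≤e = proj₂ (⊕-closed′ (below x≤e) (below y≤e))

    neg : (x : M) → x ≤ e → M
    neg x x≤e = proj₁ (proj₁ mvₑ x (below x≤e))

    neg≤e : ∀ {x} (x≤e : x ≤ e) → neg x x≤e ≤ e
    neg≤e {x} x≤e = proj₂ (proj₁ (proj₁ (proj₂ (proj₁ mvₑ x (below x≤e)))))

    x⊕neg≡e : ∀ {x} (x≤e : x ≤ e) → x ⊕ neg x x≤e ≡ e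
    x⊕neg≡e {x} x≤e = proj₂ (proj₁ (proj₂ (proj₁ mvₑ x (below x≤e))))

    neg-least : ∀ {x z} (x≤e : x ≤ e) → z ≤ e → x ⊕ z ≡ e → neg x x≤e ≤ z
    neg-least {x} {z} x≤e z≤e x⊕z≡e =
      proj₂ (proj₂ (proj₁ mvₑ x (below x≤e))) z (below z≤e , x⊕z≡e)

    neg-cong : ∀ {x y} → x ≡ y → (x≤e : x ≤ e) (y≤e : y ≤ e) → neg x x≤e ≡ neg y y≤e
    neg-cong refl x≤e y≤e = neg-irrelevant (below x≤e) (below y≤e)

    neg-involutive : ∀ {x} (x≤e : x ≤ e) → neg (neg x x≤e) (neg≤e x≤e) ≡ x
    neg-involutive x≤e = trans (neg-irrelevant _ _) (neg-involutive′ (below x≤e))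

    neg-e : (e≤e : e ≤ e) → neg e e≤e ≡ o
    neg-e e≤e = antisym (neg-least e≤e (o-minimum e) (identityʳ e)) (o-minimum _)

    ≤⇒neg⊕≡e : ∀ {x y} → x ≤ y → y ≤ e → (x≤e : x ≤ e) → neg x x≤e ⊕ y ≡ e
    ≤⇒neg⊕≡e {x} {y} x≤y y≤e x≤e = antisym (⊕-closed (neg≤e x≤e) y≤e)
      (≤-trans (≤-reflexive (trans (sym (x⊕neg≡e x≤e)) (comm x _))) (⊕-mono-≤ ≤-refl x≤y))

    join : (x y : M) → x ≤ e → y ≤ e → M
    join x y x≤e y≤e = neg (neg x x≤e ⊕ y) (⊕-closed (neg≤e x≤e) y≤e) ⊕ y

    join-comm : ∀ {x y} (x≤e : x ≤ e) (y≤e : y ≤ e) → join x y x≤e y≤e ≡ join y x y≤e x≤e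
    join-comm {x} {y} x≤e y≤e = trans (cong (_⊕ y) (neg-irrelevant _ _))
      (trans (łukasiewicz (below x≤e) (below y≤e)) (cong (_⊕ x) (neg-irrelevant _ _)))

    neg⊕≡e⇒≤ : ∀ {x y} (x≤e : x ≤ e) (y≤e : y ≤ e) → neg x x≤e ⊕ y ≡ e → x ≤ y
    neg⊕≡e⇒≤ {x} {y} x≤e y≤e ¬x⊕y≡e = ≤-trans (y≤x⊕y _ x) (≤-reflexive (begin
      join y x y≤e x≤e          ≡⟨ join-comm y≤e x≤e ⟩
      join x y x≤e y≤e          ≡⟨ cong (_⊕ y) (trans (neg-cong ¬x⊕y≡e _ ≤-refl) (neg-e _)) ⟩
      o ⊕ y                     ≡⟨ identityˡ y ⟩
      y                         ∎))
      where open ≡-Reasoning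

    neg-antitone : ∀ {x y} → x ≤ y → (x≤e : x ≤ e) (y≤e : y ≤ e) → neg y y≤e ≤ neg x x≤e
    neg-antitone {x} {y} x≤y x≤e y≤e =
      neg-least y≤e (neg≤e x≤e) (trans (comm y _) (≤⇒neg⊕≡e x≤y y≤e x≤e))

    join≤e : ∀ {x y} (x≤e : x ≤ e) (y≤e : y ≤ e) → join x y x≤e y≤e ≤ e
    join≤e x≤e y≤e = ⊕-closed (neg≤e _) y≤e

    x≤join : ∀ {x y} (x≤e : x ≤ e) (y≤e : y ≤ e) → x ≤ join x y x≤e y≤e
    x≤join {x} {y} x≤e y≤e = ≤-trans (y≤x⊕y _ x) (≤-reflexive (join-comm y≤e x≤e))

    y≤join : ∀ {x y} (x≤e : x ≤ e) (y≤e : y ≤ e) → y ≤ join x y x≤e y≤e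
    y≤join {x} {y} x≤e y≤e = y≤x⊕y _ y

    join-least : ∀ {x y u} (x≤e : x ≤ e) (y≤e : y ≤ e) → u ≤ e → x ≤ u → y ≤ u →
                 join x y x≤e y≤e ≤ u
    join-least {x} {y} {u} x≤e y≤e u≤e x≤u y≤u with natural⇒ y≤u
    ... | w , y⊕w≡u = ≤-trans (⊕-mono-≤ ¬[¬x⊕y]≤w ≤-refl) (≤-reflexive (trans (comm w y) y⊕w≡u))
      where
      w≤e : w ≤ e
      w≤e = ≤-trans (subst (w ≤_) y⊕w≡u (y≤x⊕y y w)) u≤e
      ¬x⊕y⊕w≡e : (neg x x≤e ⊕ y) ⊕ w ≡ e
      ¬x⊕y⊕w≡e = trans (assoc _ y w) (trans (cong (neg x x≤e ⊕_) y⊕w≡u) (≤⇒neg⊕≡e x≤u u≤e x≤e))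
      ¬[¬x⊕y]≤w = neg-least _ w≤e ¬x⊕y⊕w≡e

    prod : (x y : M) → x ≤ e → y ≤ e → M
    prod x y x≤e y≤e = neg (neg x x≤e ⊕ neg y y≤e) (⊕-closed (neg≤e x≤e) (neg≤e y≤e))

    prod≤e : ∀ {x y} (x≤e : x ≤ e) (y≤e : y ≤ e) → prod x y x≤e y≤e ≤ e
    prod≤e x≤e y≤e = neg≤e _

    residual⇒ : ∀ {x y z} (x≤e : x ≤ e) (y≤e : y ≤ e) (z≤e : z ≤ e) →
                prod x y x≤e y≤e ≤ z → x ≤ (neg y y≤e ⊕ z)
    residual⇒ {x} {y} {z} x≤e y≤e z≤e x⊙y≤z = neg⊕≡e⇒≤ x≤e (⊕-closed (neg≤e y≤e) z≤e)
      (trans (sym (assoc _ _ z)) (trans (cong (_⊕ z) (sym (neg-involutive _)))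
        (≤⇒neg⊕≡e x⊙y≤z z≤e (prod≤e x≤e y≤e))))

    residual⇐ : ∀ {x y z} (x≤e : x ≤ e) (y≤e : y ≤ e) (z≤e : z ≤ e) →
                x ≤ (neg y y≤e ⊕ z) → prod x y x≤e y≤e ≤ z
    residual⇐ {x} {y} {z} x≤e y≤e z≤e x≤¬y⊕z = neg⊕≡e⇒≤ (prod≤e x≤e y≤e) z≤e
      (trans (cong (_⊕ z) (neg-involutive _))
        (trans (assoc _ _ z) (≤⇒neg⊕≡e x≤¬y⊕z (⊕-closed (neg≤e y≤e) z≤e) x≤e)))

    prod-monoʳ : ∀ {x y y′} (x≤e : x ≤ e) (y≤e : y ≤ e) (y′≤e : y′ ≤ e) → y ≤ y′ →
                 prod x y x≤e y≤e ≤ prod x y′ x≤e y′≤e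
    prod-monoʳ x≤e y≤e y′≤e y≤y′ = residual⇐ x≤e y≤e (prod≤e x≤e y′≤e)
      (≤-trans (residual⇒ x≤e y′≤e (prod≤e x≤e y′≤e) ≤-refl)
        (⊕-mono-≤ (neg-antitone y≤y′ y≤e y′≤e) ≤-refl))

    prod-preserves-lub : ∀ {x y d z w} (x≤e : x ≤ e) (y≤e : y ≤ e) (d≤e : d ≤ e) (z≤e : z ≤ e) →
                         w ≤ e → (∀ v → x ≤ v → y ≤ v → d ≤ v) →
                         prod x z x≤e z≤e ≤ w → prod y z y≤e z≤e ≤ w → prod d z d≤e z≤e ≤ w
    prod-preserves-lub x≤e y≤e d≤e z≤e w≤e d-least x⊙z≤w y⊙z≤w = residual⇐ d≤e z≤e w≤e
      (d-least _ (residual⇒ x≤e z≤e w≤e x⊙z≤w) (residual⇒ y≤e z≤e w≤e y⊙z≤w))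

    meet : (x y : M) → x ≤ e → y ≤ e → M
    meet x y x≤e y≤e = prod x (neg x x≤e ⊕ y) x≤e (⊕-closed (neg≤e x≤e) y≤e)

    meet≤x : ∀ {x y} (x≤e : x ≤ e) (y≤e : y ≤ e) → meet x y x≤e y≤e ≤ x
    meet≤x x≤e y≤e = residual⇐ x≤e _ x≤e (y≤x⊕y _ _)

    meet≤y : ∀ {x y} (x≤e : x ≤ e) (y≤e : y ≤ e) → meet x y x≤e y≤e ≤ y
    meet≤y x≤e y≤e = residual⇐ x≤e _ y≤e (x≤join x≤e y≤e)

    -- ¬x ⊕ ¬(¬x ⊕ l) is the join of ¬l and ¬x, which is ¬l as ¬x ≤ ¬l.
    meet-greatest : ∀ {x y l} (x≤e : x ≤ e) (y≤e : y ≤ e) → l ≤ x → l ≤ y → l ≤ meet x y x≤e y≤e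
    meet-greatest {x} {y} {l} x≤e y≤e l≤x l≤y = ≤-trans l≤meet-x-l
      (prod-monoʳ x≤e _ _ (⊕-mono-≤ ≤-refl l≤y))
      where
      l≤e = ≤-trans l≤x x≤e
      ¬x⊕l≤e = ⊕-closed (neg≤e x≤e) l≤e
      ¬x⊕¬[¬x⊕l]≡join : neg x x≤e ⊕ neg (neg x x≤e ⊕ l) ¬x⊕l≤e
                        ≡ join (neg l l≤e) (neg x x≤e) (neg≤e l≤e) (neg≤e x≤e)
      ¬x⊕¬[¬x⊕l]≡join = trans (comm _ _) (cong (_⊕ neg x x≤e)
        (neg-cong (trans (comm _ _) (cong (_⊕ neg x x≤e) (sym (neg-involutive l≤e)))) _ _))
      ¬x⊕¬[¬x⊕l]≤¬l = ≤-trans (≤-reflexive ¬x⊕¬[¬x⊕l]≡join)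
        (join-least (neg≤e l≤e) (neg≤e x≤e) (neg≤e l≤e) ≤-refl (neg-antitone l≤x l≤e x≤e))
      l≤meet-x-l : l ≤ meet x l x≤e l≤e
      l≤meet-x-l = ≤-trans (≤-reflexive (sym (neg-involutive l≤e)))
        (neg-antitone ¬x⊕¬[¬x⊕l]≤¬l _ (neg≤e l≤e))

  join-independent : ∀ {e f} (mvₑ : IntervalMV _⊕_ o _≤_ e) (mv_f : IntervalMV _⊕_ o _≤_ f)
                     (e≤f : e ≤ f) {x y} (x≤e : x ≤ e) (y≤e : y ≤ e) →
                     Interval.join e mvₑ x y x≤e y≤e
                       ≡ Interval.join f mv_f x y (≤-trans x≤e e≤f) (≤-trans y≤e e≤f)
  join-independent {e} {f} mvₑ mv_f e≤f x≤e y≤e = antisym joinₑ≤join_f join_f≤joinₑ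
    where
    module E = Interval e mvₑ
    module F = Interval f mv_f
    x≤f = ≤-trans x≤e e≤f
    y≤f = ≤-trans y≤e e≤f
    join_f≤joinₑ = F.join-least x≤f y≤f (≤-trans (E.join≤e x≤e y≤e) e≤f)
                     (E.x≤join x≤e y≤e) (E.y≤join x≤e y≤e)
    joinₑ≤join_f = E.join-least x≤e y≤e (≤-trans join_f≤joinₑ (E.join≤e x≤e y≤e))
                     (F.x≤join x≤f y≤f) (F.y≤join x≤f y≤f)


module Construction {M : Set} {_⊕_ : M → M → M} {o : M} {_≤_ : M → M → Set}
  (isNOCM : IsNaturallyOrderedCommMonoid _⊕_ o _≤_)
  (intervalMV : ∀ a → Idempotent _⊕_ a → IntervalMV _⊕_ o _≤_ a)
  (idempotent-above : ∀ x → ∃ λ a → Idempotent _⊕_ a × (x ≤ a)) where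

  open NaturallyOrdered isNOCM

  ⌈_⌉ : M → M
  ⌈ x ⌉ = proj₁ (idempotent-above x)

  ⌈⌉-idempotent : ∀ x → Idempotent _⊕_ ⌈ x ⌉
  ⌈⌉-idempotent x = proj₁ (proj₂ (idempotent-above x))

  x≤⌈x⌉ : ∀ x → x ≤ ⌈ x ⌉
  x≤⌈x⌉ x = proj₂ (proj₂ (idempotent-above x))

  ⌈_⊔_⌉ : M → M → M
  ⌈ x ⊔ y ⌉ = ⌈ x ⌉ ⊕ ⌈ y ⌉

  ⌈⊔⌉-idempotent : ∀ x y → Idempotent _⊕_ ⌈ x ⊔ y ⌉
  ⌈⊔⌉-idempotent x y = idempotent-⊕ (⌈⌉-idempotent x) (⌈⌉-idempotent y)

  x≤⌈x⊔y⌉ : ∀ x y → x ≤ ⌈ x ⊔ y ⌉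
  x≤⌈x⊔y⌉ x y = ≤-trans (x≤⌈x⌉ x) (x≤x⊕y _ _)

  y≤⌈x⊔y⌉ : ∀ x y → y ≤ ⌈ x ⊔ y ⌉
  y≤⌈x⊔y⌉ x y = ≤-trans (x≤⌈x⌉ y) (y≤x⊕y _ _)

  mv⌈_⊔_⌉ : ∀ x y → IntervalMV _⊕_ o _≤_ ⌈ x ⊔ y ⌉
  mv⌈ x ⊔ y ⌉ = intervalMV _ (⌈⊔⌉-idempotent x y)

  module Local (x y : M) = Interval ⌈ x ⊔ y ⌉ mv⌈ x ⊔ y ⌉

  _∨_ : M → M → M
  x ∨ y = Local.join x y x y (x≤⌈x⊔y⌉ x y) (y≤⌈x⊔y⌉ x y)

  _∧_ : M → M → M
  x ∧ y = Local.meet x y x y (x≤⌈x⊔y⌉ x y) (y≤⌈x⊔y⌉ x y)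

  x≤x∨y : ∀ x y → x ≤ (x ∨ y)
  x≤x∨y x y = Local.x≤join x y (x≤⌈x⊔y⌉ x y) (y≤⌈x⊔y⌉ x y)

  y≤x∨y : ∀ x y → y ≤ (x ∨ y)
  y≤x∨y x y = Local.y≤join x y (x≤⌈x⊔y⌉ x y) (y≤⌈x⊔y⌉ x y)

  -- The join in [o , ⌈ x ⊔ y ⌉] agrees with the join in the larger
  -- interval [o , ⌈ x ⊔ y ⌉ ⊕ ⌈ u ⌉], which contains u.
  ∨-least : ∀ {x y u} → x ≤ u → y ≤ u → (x ∨ y) ≤ u
  ∨-least {x} {y} {u} x≤u y≤u = ≤-trans
    (≤-reflexive (join-independent mv⌈ x ⊔ y ⌉ mvᶠ (x≤x⊕y _ _) (x≤⌈x⊔y⌉ x y) (y≤⌈x⊔y⌉ x y)))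
    (Interval.join-least _ mvᶠ _ _ (≤-trans (x≤⌈x⌉ u) (y≤x⊕y _ _)) x≤u y≤u)
    where
    mvᶠ : IntervalMV _⊕_ o _≤_ (⌈ x ⊔ y ⌉ ⊕ ⌈ u ⌉)
    mvᶠ = intervalMV _ (idempotent-⊕ (⌈⊔⌉-idempotent x y) (⌈⌉-idempotent u))

  x∧y≤x : ∀ x y → (x ∧ y) ≤ x
  x∧y≤x x y = Local.meet≤x x y (x≤⌈x⊔y⌉ x y) (y≤⌈x⊔y⌉ x y)

  x∧y≤y : ∀ x y → (x ∧ y) ≤ y
  x∧y≤y x y = Local.meet≤y x y (x≤⌈x⊔y⌉ x y) (y≤⌈x⊔y⌉ x y)

  ∧-greatest : ∀ {x y l} → l ≤ x → l ≤ y → l ≤ (x ∧ y)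
  ∧-greatest {x} {y} = Local.meet-greatest x y (x≤⌈x⊔y⌉ x y) (y≤⌈x⊔y⌉ x y)

  supremum : Supremum _≤_ _∨_
  supremum x y = x≤x∨y x y , y≤x∨y x y , λ _ → ∨-least

  infimum : Infimum _≤_ _∧_
  infimum x y = x∧y≤x x y , x∧y≤y x y , λ _ → ∧-greatest

  -- In [o , e] with d = y ∨ z and X = ¬d ⊕ x:
  -- x ∧ d ≤ d ∧ₑ x = d ⊙ X ≤ (y ⊙ X) ∨ (z ⊙ X), and w ⊙ X ≤ w ⊙ (¬w ⊕ x) = w ∧ₑ x for w ≤ d.
  ∧-distribˡ-∨-≤ : ∀ x y z → (x ∧ (y ∨ z)) ≤ ((x ∧ y) ∨ (x ∧ z))
  ∧-distribˡ-∨-≤ x y z = ≤-trans x∧d≤d⊙X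
    (prod-preserves-lub y≤e z≤e d≤e X≤e (∨-least (below-x (x∧y≤x x y)) (below-x (x∧y≤x x z)))
      (λ _ → ∨-least) (≤-trans (w⊙X≤x∧w y≤e (x≤x∨y y z)) (x≤x∨y _ _))
                      (≤-trans (w⊙X≤x∧w z≤e (y≤x∨y y z)) (y≤x∨y _ _)))
    where
    d = y ∨ z
    open Local x d
    x≤e = x≤⌈x⊔y⌉ x d
    d≤e = y≤⌈x⊔y⌉ x d
    y≤e = ≤-trans (x≤x∨y y z) d≤e
    z≤e = ≤-trans (y≤x∨y y z) d≤e
    below-x : ∀ {w} → w ≤ x → w ≤ ⌈ x ⊔ d ⌉
    below-x w≤x = ≤-trans w≤x x≤e
    X≤e = ⊕-closed (neg≤e d≤e) x≤e
    x∧d≤d⊙X : (x ∧ d) ≤ meet d x d≤e x≤e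
    x∧d≤d⊙X = meet-greatest d≤e x≤e (x∧y≤y x d) (x∧y≤x x d)
    w⊙X≤x∧w : ∀ {w} (w≤e : w ≤ ⌈ x ⊔ d ⌉) → w ≤ d → prod w (neg d d≤e ⊕ x) w≤e X≤e ≤ (x ∧ w)
    w⊙X≤x∧w w≤e w≤d = ≤-trans
      (prod-monoʳ w≤e X≤e (⊕-closed (neg≤e w≤e) x≤e) (⊕-mono-≤ (neg-antitone w≤d w≤e d≤e) ≤-refl))
      (∧-greatest (meet≤y w≤e x≤e) (meet≤x w≤e x≤e))

  ∧-distribˡ-∨ : ∀ x y z → (x ∧ (y ∨ z)) ≡ ((x ∧ y) ∨ (x ∧ z))
  ∧-distribˡ-∨ x y z = antisym (∧-distribˡ-∨-≤ x y z)
    (∨-least (∧-greatest (x∧y≤x x y) (≤-trans (x∧y≤y x y) (x≤x∨y y z)))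
             (∧-greatest (x∧y≤x x z) (≤-trans (x∧y≤y x z) (y≤x∨y y z))))

  isDistributiveLattice : OL.IsDistributiveLattice _≡_ _≤_ _∨_ _∧_
  isDistributiveLattice = record
    { isLattice    = record { isPartialOrder = isPartialOrder ; supremum = supremum ; infimum = infimum }
    ; ∧-distribˡ-∨ = ∧-distribˡ-∨
    }

  ≤⇒latticeOrder : ∀ {x y} → x ≤ y → LatticeOrder _∧_ x y
  ≤⇒latticeOrder {x} {y} x≤y = antisym (x∧y≤x x y) (∧-greatest ≤-refl x≤y)

  latticeOrder⇒≤ : ∀ {x y} → LatticeOrder _∧_ x y → x ≤ y
  latticeOrder⇒≤ {x} {y} x∧y≡x = subst (_≤ y) x∧y≡x (x∧y≤y x y)

  isEMVAlgebra : IsEMVAlgebra _∨_ _∧_ _⊕_ o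
  isEMVAlgebra = record
    { isCommutativeMonoid   = isCommutativeMonoid
    ; isDistributiveLattice = record
      { isLattice   = LatticeProperties.isAlgLattice (DistributiveLattice.lattice lattice)
      ; ∨-distrib-∧ = DistributiveLatticeProperties.∨-distrib-∧ lattice
      ; ∧-distrib-∨ = DistributiveLatticeProperties.∧-distrib-∨ lattice
      }
    ; o-bottom  = λ x → ≤⇒latticeOrder (o-minimum x)
    ; intervals = λ a a⊕a≡a → intervalMV-resp ≤⇒latticeOrder latticeOrder⇒≤ (intervalMV a a⊕a≡a)
    ; bounded   = λ x → ⌈ x ⌉ , ⌈⌉-idempotent x , ≤⇒latticeOrder (x≤⌈x⌉ x)
    }
    where
    lattice : DistributiveLattice _ _ _
    lattice = record { isDistributiveLattice = isDistributiveLattice }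

proposition3p1 : (M : Set) (_⊕_ : M → M → M) (o : M) (_≤_ : M → M → Set) →
    IsNaturallyOrderedCommMonoid _⊕_ o _≤_ →
    (∀ a → Idempotent _⊕_ a → IntervalMV _⊕_ o _≤_ a) →
    (∀ x → ∃ λ a → Idempotent _⊕_ a × (x ≤ a)) →
    Σ (M → M → M) λ _∨_ → Σ (M → M → M) λ _∧_ →
    OL.IsDistributiveLattice _≡_ _≤_ _∨_ _∧_ × Minimum _≤_ o
    × IsEMVAlgebra _∨_ _∧_ _⊕_ o
proposition3p1 M _⊕_ o _≤_ isNOCM intervalMV idempotent-above =
  _∨_ , _∧_ , isDistributiveLattice , o-minimum , isEMVAlgebra
  where
  open NaturallyOrdered isNOCM using (o-minimum)
  open Construction isNOCM intervalMV idempotent-above
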